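{- Let $G$ be the undirected graph and $\mathcal{P}$ the path family described in the context. Each path in $\mathcal{P}$ is the only $13/12$-approximate shortest path between its endpoints in $G$.
   Context: Let $n$ be divisible by $5$ and $m=n/5$. The undirected graph $G=(V,E,w)$ has vertices $v_i^1,\dots,v_i^5$ for $i=1,\dots,m$; the cycle $C_i$ consists of edges $\{v_i^1,v_i^2\},\{v_i^2,v_i^3\},\{v_i^3,v_i^4\},\{v_i^4,v_i^5\},\{v_i^5,v_i^1\}$. For every $i<m$ the cross-cycle edges between $C_i$ and $C_{i+1}$ are $\{v_i^1,v_{i+1}^1\},\{v_i^2,v_{i+1}^3\},\{v_i^3,v_{i+1}^5\},\{v_i^4,v_{i+1}^2\},\{v_i^5,v_{i+1}^4\}$. Every edge of $C_i$ has weight $1/3^i$; every cross-cycle edge between $C_i$ and $C_{i+1}$ has weight $1/3^{i-1}$. Superscripts are taken modulo $5$ in $\{1,\dots,5\}$. The family $\mathcal{P}$: for each $i<m$ and each vertex $v_i^k$, letting $v_{i+1}^j$ be the endpoint of the cross-cycle edge at $v_i^k$ going to $C_{i+1}$, $\mathcal{P}$ contains the path $v_i^k, v_{i+1}^j, v_{i+1}^{j+1}, v_{i+1}^{j+2}$. A path from $s$ to $t$ is an $\alpha$-approximate shortest path if its weight is at most $\alpha$ times the $s$-$t$ distance. -}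

module Defs where

open import Data.Nat using (ℕ; zero; suc)
open import Data.Fin using (Fin; zero; suc; toℕ)
open import Data.Integer using (+_)
open import Data.Rational using (ℚ; 0ℚ; 1ℚ; _/_; _+_; _*_; _≤_)
open import Data.Product using (_×_; _,_)
open import Data.List using (List; []; _∷_)
open import Data.List.Relation.Unary.Unique.Propositional using (Unique)
open import Relation.Binary.PropositionalEquality using (_≡_)

-- Vertex v_i^k is represented as (i , k) with i : Fin m standing for
-- cycle index toℕ i + 1 and k : Fin 5 standing for superscript toℕ k + 1.
V : ℕ → Set
V m = Fin m × Fin 5

next : Fin 5 → Fin 5
next zero = suc zero
next (suc zero) = suc (suc zero)
next (suc (suc zero)) = suc (suc (suc zero))
next (suc (suc (suc zero))) = suc (suc (suc (suc zero)))
next (suc (suc (suc (suc zero)))) = zero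

-- cross-cycle superscript map: 1↦1, 2↦3, 3↦5, 4↦2, 5↦4 (0-based: 0↦0,1↦2,2↦4,3↦1,4↦3)
cross : Fin 5 → Fin 5
cross zero = zero
cross (suc zero) = suc (suc zero)
cross (suc (suc zero)) = suc (suc (suc (suc zero)))
cross (suc (suc (suc zero))) = suc zero
cross (suc (suc (suc (suc zero)))) = suc (suc (suc zero))

inv3^ : ℕ → ℚ
inv3^ zero = 1ℚ
inv3^ (suc e) = inv3^ e * (+ 1 / 3)

-- Oriented edges of the undirected graph G (each undirected edge appears in
-- both orientations).
data Edge {m : ℕ} : V m → V m → Set where
  cyc     : (i : Fin m) (k : Fin 5) → Edge (i , k) (i , next k)
  cycᵒ    : (i : Fin m) (k : Fin 5) → Edge (i , next k) (i , k)
  crossE  : (i j : Fin m) → toℕ j ≡ suc (toℕ i) → (k : Fin 5) →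
            Edge (i , k) (j , cross k)
  crossEᵒ : (i j : Fin m) → toℕ j ≡ suc (toℕ i) → (k : Fin 5) →
            Edge (j , cross k) (i , k)

-- Edge weights: cycle C_i edges weigh 1/3^i, cross edges between C_i and
-- C_{i+1} weigh 1/3^(i-1) (with paper index i = toℕ i + 1).
weightE : {m : ℕ} {u v : V m} → Edge u v → ℚ
weightE (cyc i k) = inv3^ (suc (toℕ i))
weightE (cycᵒ i k) = inv3^ (suc (toℕ i))
weightE (crossE i j _ k) = inv3^ (toℕ i)
weightE (crossEᵒ i j _ k) = inv3^ (toℕ i)

data Walk {m : ℕ} : V m → V m → Set where
  [_]  : (v : V m) → Walk v v
  _∷_  : {u v t : V m} → Edge u v → Walk v t → Walk u t

vertices : {m : ℕ} {s t : V m} → Walk s t → List (V m)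
vertices [ v ] = v ∷ []
vertices (_∷_ {u = u} e p) = u ∷ vertices p

weight : {m : ℕ} {s t : V m} → Walk s t → ℚ
weight [ v ] = 0ℚ
weight (e ∷ p) = weightE e + weight p

IsPath : {m : ℕ} {s t : V m} → Walk s t → Set
IsPath p = Unique (vertices p)

-- α-approximate shortest path: weight at most α · dist(s,t), where dist(s,t)
-- is the minimum weight of an s-t path; unfolded as: at most α times the
-- weight of every s-t path.
IsApproxSP : {m : ℕ} {s t : V m} → ℚ → Walk s t → Set
IsApproxSP {m} {s} {t} α p =
  IsPath p × ((q : Walk s t) → IsPath q → weight p ≤ α * weight q)

𝒫-path : {m : ℕ} (i j : Fin m) (k : Fin 5) → List (V m)
𝒫-path i j k =
  (i , k) ∷ (j , cross k) ∷ (j , next (cross k)) ∷ (j , next (next (cross k))) ∷ []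

{-# OPTIONS --safe #-}
-- Let X be the weight of the cross edges between C_i and C_{i+1} and Y that of the edges of
-- C_{i+1}, so X = 9Y, and the path of 𝒫 weighs X + 2Y = 11Y. A walk that leaves v_i^k along
-- any other edge pays at least 3Y for it and must still cross from C_{≤ i} to C_{i+1}, paying X.
-- A walk that takes the cross edge and then deviates from the two forward arcs of C_{i+1} pays
-- at least 3Y there: leaving C_{i+1} costs 3Y, and a backward first step leaves the target three
-- steps ahead. So every other walk weighs at least X + 3Y = 12Y > (13/12) · 11Y.
module Submission where

open import Data.Nat using (ℕ; suc)
open import Data.Nat.DivMod using (_/_)
open import Data.Nat.Divisibility using (_∣_)
open import Data.Fin using (Fin; toℕ)
open import Data.Integer using (+_)
open import Data.Rational using () renaming (_/_ to _/ℚ_)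
open import Data.Product using (_×_; _,_; Σ)
open import Relation.Binary.PropositionalEquality using (_≡_)
open import Defs

import Data.Nat as ℕ
import Data.Nat.Properties as ℕ
open import Data.Fin using (#_)
open import Data.Fin.Properties using (toℕ-injective; all?; _≟_)
open import Data.Rational using (ℚ; 0ℚ; 1ℚ; _+_; _*_; _≤_; _<_; positive; nonNegative; _≤?_; _<?_)
open import Data.Rational.Properties hiding (_≟_)
open import Data.Rational.Solver using (module +-*-Solver)
open import Data.Product using (proj₁)
open import Data.Product.Properties using (,-injectiveʳ)
open import Data.Sum using (_⊎_; inj₁; inj₂; map)
open import Data.Empty using (⊥-elim)
open import Data.List using (_∷_; [])
open import Data.List.Relation.Unary.All using (_∷_; [])
open import Data.List.Relation.Unary.AllPairs using (_∷_; [])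
open import Data.Unit using (tt)
open import Function using (_∘_)
open import Relation.Nullary using (yes; no)
open import Relation.Nullary.Decidable using (toWitness; ¬?)
open import Relation.Binary.PropositionalEquality using (_≢_; refl; sym; trans; cong; cong₂; subst; subst₂)

⅓ : ℚ
⅓ = + 1 /ℚ 3

p≤p+q : ∀ {p q} → 0ℚ ≤ q → p ≤ p + q
p≤p+q {p} 0≤q = ≤-trans (≤-reflexive (sym (+-identityʳ p))) (+-monoʳ-≤ p 0≤q)

p≤q+p : ∀ {p q} → 0ℚ ≤ q → p ≤ q + p
p≤q+p {p} {q} 0≤q = ≤-trans (p≤p+q 0≤q) (≤-reflexive (+-comm p q))

p≤r*p : ∀ {r p} → 1ℚ ≤ r → 0ℚ ≤ p → p ≤ r * p
p≤r*p {p = p} 1≤r 0≤p = let instance _ = nonNegative 0≤p in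
  ≤-trans (≤-reflexive (sym (*-identityˡ p))) (*-monoʳ-≤-nonNeg p 1≤r)

inv3^-positive : ∀ e → 0ℚ < inv3^ e
inv3^-positive ℕ.zero = positive⁻¹ 1ℚ
inv3^-positive (suc e) = let instance _ = positive (inv3^-positive e) in
  positive⁻¹ (inv3^ e * ⅓) {{pos*pos⇒pos (inv3^ e) ⅓}}

inv3^-nonNeg : ∀ e → 0ℚ ≤ inv3^ e
inv3^-nonNeg e = <⇒≤ (inv3^-positive e)

inv3^-suc-≤ : ∀ e → inv3^ (suc e) ≤ inv3^ e
inv3^-suc-≤ e = let instance _ = nonNegative (inv3^-nonNeg e) in
  ≤-trans (*-monoˡ-≤-nonNeg (inv3^ e) (toWitness {a? = ⅓ ≤? 1ℚ} tt))
          (≤-reflexive (*-identityʳ (inv3^ e)))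

inv3^-triple : ∀ e → inv3^ (suc e) + (inv3^ (suc e) + inv3^ (suc e)) ≡ inv3^ e
inv3^-triple e = trans (factor (inv3^ e) ⅓) (*-identityʳ (inv3^ e))
  where
  open +-*-Solver
  factor : ∀ x t → x * t + (x * t + x * t) ≡ x * (t + (t + t))
  factor = solve 2 (λ x t → x :* t :+ (x :* t :+ x :* t) := x :* (t :+ (t :+ t))) refl

inv3^-double-≤ : ∀ e → inv3^ (suc e) + inv3^ (suc e) ≤ inv3^ e
inv3^-double-≤ e = ≤-trans (+-monoʳ-≤ (inv3^ (suc e)) (p≤p+q (inv3^-nonNeg (suc e))))
                           (≤-reflexive (inv3^-triple e))

level : ∀ {m} → V m → ℕ
level = toℕ ∘ proj₁

cycle-weight : ∀ {m} → Fin m → ℚ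
cycle-weight ℓ = inv3^ (suc (toℕ ℓ))

next^ : ℕ → Fin 5 → Fin 5
next^ ℕ.zero x = x
next^ (suc r) x = next (next^ r x)

next^-≢ : ∀ (r : Fin 4) x → x ≢ next^ (suc (toℕ r)) x
next^-≢ = toWitness {a? = all? λ r → all? λ x → ¬? (x ≟ next^ (suc (toℕ r)) x)} tt

module _ {m : ℕ} where

  crossEᵒ-weight : ∀ {i j : Fin m} (j≡1+i : toℕ j ≡ suc (toℕ i)) (k : Fin 5) →
                   inv3^ (toℕ j) ≤ weightE (crossEᵒ i j j≡1+i k)
  crossEᵒ-weight {i} j≡1+i k rewrite j≡1+i = inv3^-suc-≤ (toℕ i)

  weightE-≥-source : ∀ {u v : V m} (e : Edge u v) → inv3^ (suc (level u)) ≤ weightE e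
  weightE-≥-source (cyc i k) = ≤-refl
  weightE-≥-source (cycᵒ i k) = ≤-refl
  weightE-≥-source (crossE i j _ k) = inv3^-suc-≤ (toℕ i)
  weightE-≥-source (crossEᵒ i j j≡1+i k) =
    ≤-trans (inv3^-suc-≤ (toℕ j)) (crossEᵒ-weight j≡1+i k)

  weightE-nonNeg : ∀ {u v : V m} (e : Edge u v) → 0ℚ ≤ weightE e
  weightE-nonNeg {u} e = ≤-trans (inv3^-nonNeg (suc (level u))) (weightE-≥-source e)

  weight-nonNeg : ∀ {u v : V m} (q : Walk u v) → 0ℚ ≤ weight q
  weight-nonNeg [ v ] = ≤-refl
  weight-nonNeg (e ∷ q) = ≤-trans (≤-reflexive (sym (+-identityʳ 0ℚ)))
                                  (+-mono-≤ (weightE-nonNeg e) (weight-nonNeg q))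

  weight-≥-head : ∀ {c} {u v t : V m} (e : Edge u v) (q : Walk v t) →
                  c ≤ weightE e → c ≤ weight (e ∷ q)
  weight-≥-head e q c≤e = ≤-trans c≤e (p≤p+q (weight-nonNeg q))

  weight-≥-distinct : ∀ {u v : V m} (q : Walk u v) → u ≢ v → inv3^ (suc (level u)) ≤ weight q
  weight-≥-distinct [ v ] u≢v = ⊥-elim (u≢v refl)
  weight-≥-distinct (e ∷ q) _ = weight-≥-head e q (weightE-≥-source e)

  weightE-≥-cut : ∀ a {u v : V m} (e : Edge u v) →
                  level u ℕ.≤ a → a ℕ.< level v → inv3^ a ≤ weightE e
  weightE-≥-cut a (cyc i k) u≤a a<v = ⊥-elim (ℕ.<⇒≱ a<v u≤a)
  weightE-≥-cut a (cycᵒ i k) u≤a a<v = ⊥-elim (ℕ.<⇒≱ a<v u≤a)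
  weightE-≥-cut a (crossE i j j≡1+i k) u≤a a<v rewrite j≡1+i =
    ≤-reflexive (cong inv3^ (ℕ.≤-antisym (ℕ.≤-pred a<v) u≤a))
  weightE-≥-cut a (crossEᵒ i j j≡1+i k) u≤a a<v rewrite j≡1+i =
    ⊥-elim (ℕ.<⇒≱ a<v (ℕ.≤-trans (ℕ.n≤1+n _) u≤a))

  weight-≥-cut : ∀ a {u v : V m} (q : Walk u v) →
                 level u ℕ.≤ a → a ℕ.< level v → inv3^ a ≤ weight q
  weight-≥-cut a [ v ] u≤a a<v = ⊥-elim (ℕ.<⇒≱ a<v u≤a)
  weight-≥-cut a (_∷_ {v = w} e q) u≤a a<v with level w ℕ.≤? a
  ... | yes w≤a = ≤-trans (weight-≥-cut a q w≤a a<v) (p≤q+p (weightE-nonNeg e))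
  ... | no w≰a = weight-≥-head e q (weightE-≥-cut a e u≤a (ℕ.≰⇒> w≰a))

  record _≋_ {s t s′ t′ : V m} (p : Walk s t) (q : Walk s′ t′) : Set where
    constructor _,_
    field
      same-vertices : vertices p ≡ vertices q
      same-weight   : weight p ≡ weight q

  ∷-≋ : ∀ {u v v′ t t′ : V m} {e : Edge u v} {e′ : Edge u v′}
          {p : Walk v t} {q : Walk v′ t′} →
        weightE e ≡ weightE e′ → p ≋ q → (e ∷ p) ≋ (e′ ∷ q)
  ∷-≋ e≡e′ (vp≡vq , wp≡wq) = cong (_ ∷_) vp≡vq , cong₂ _+_ e≡e′ wp≡wq

module _ {m : ℕ} (ℓ : Fin m) where

  private
    Y : ℚ
    Y = cycle-weight ℓ

  rotate-≢ : ∀ r {x} → (ℓ , x) ≢ (ℓ , next^ (suc (toℕ r)) x)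
  rotate-≢ r {x} = next^-≢ r x ∘ ,-injectiveʳ

  arc : (x : Fin 5) → Walk (ℓ , x) (ℓ , next x)
  arc x = cyc ℓ x ∷ [ ℓ , next x ]

  arc² : (x : Fin 5) → Walk (ℓ , x) (ℓ , next (next x))
  arc² x = cyc ℓ x ∷ arc (next x)

  arc-or-≥2 : ∀ {x v} (q : Walk (ℓ , x) v) → v ≡ (ℓ , next x) →
              q ≋ arc x ⊎ Y + Y ≤ weight q
  arc-or-≥2 [ _ ] v≡ = ⊥-elim (rotate-≢ (# 0) v≡)
  arc-or-≥2 (cyc _ _ ∷ [ _ ]) _ = inj₁ (refl , refl)
  arc-or-≥2 (cyc _ _ ∷ e ∷ q) _ =
    inj₂ (+-monoʳ-≤ Y (weight-≥-head e q (weightE-≥-source e)))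
  arc-or-≥2 (cycᵒ _ _ ∷ q) v≡ =
    inj₂ (+-monoʳ-≤ Y (weight-≥-distinct q (λ eq → rotate-≢ (# 1) (trans eq v≡))))
  arc-or-≥2 (e@(crossE _ _ _ _) ∷ q) _ = inj₂ (weight-≥-head e q (inv3^-double-≤ (toℕ ℓ)))
  arc-or-≥2 (e@(crossEᵒ _ _ j≡1+i k) ∷ q) _ =
    inj₂ (weight-≥-head e q (≤-trans (inv3^-double-≤ (toℕ ℓ)) (crossEᵒ-weight j≡1+i k)))

  three-apart-≥2 : ∀ {x v} (q : Walk (ℓ , x) v) → v ≡ (ℓ , next^ 3 x) → Y + Y ≤ weight q
  three-apart-≥2 [ _ ] v≡ = ⊥-elim (rotate-≢ (# 2) v≡)
  three-apart-≥2 (cyc _ _ ∷ q) v≡ =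
    +-monoʳ-≤ Y (weight-≥-distinct q (λ eq → rotate-≢ (# 1) (trans eq v≡)))
  three-apart-≥2 (cycᵒ _ _ ∷ q) v≡ =
    +-monoʳ-≤ Y (weight-≥-distinct q (λ eq → rotate-≢ (# 3) (trans eq v≡)))
  three-apart-≥2 (e@(crossE _ _ _ _) ∷ q) _ = weight-≥-head e q (inv3^-double-≤ (toℕ ℓ))
  three-apart-≥2 (e@(crossEᵒ _ _ j≡1+i k) ∷ q) _ =
    weight-≥-head e q (≤-trans (inv3^-double-≤ (toℕ ℓ)) (crossEᵒ-weight j≡1+i k))

  arc²-or-≥3 : ∀ {x v} (q : Walk (ℓ , x) v) → v ≡ (ℓ , next (next x)) →
               q ≋ arc² x ⊎ Y + (Y + Y) ≤ weight q
  arc²-or-≥3 [ _ ] v≡ = ⊥-elim (rotate-≢ (# 1) v≡)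
  arc²-or-≥3 (cyc _ _ ∷ q) v≡ = map (∷-≋ refl) (+-monoʳ-≤ Y) (arc-or-≥2 q v≡)
  arc²-or-≥3 (cycᵒ _ _ ∷ q) v≡ = inj₂ (+-monoʳ-≤ Y (three-apart-≥2 q v≡))
  arc²-or-≥3 (e@(crossE _ _ _ _) ∷ q) _ =
    inj₂ (weight-≥-head e q (≤-reflexive (inv3^-triple (toℕ ℓ))))
  arc²-or-≥3 (e@(crossEᵒ _ _ j≡1+i k) ∷ q) _ =
    inj₂ (weight-≥-head e q (≤-trans (≤-reflexive (inv3^-triple (toℕ ℓ)))
                                     (crossEᵒ-weight j≡1+i k)))

13/12 : ℚ
13/12 = + 13 /ℚ 12

13/12-gap : ∀ X → 0ℚ < X →
            let Y = X * ⅓ * ⅓ in 13/12 * (X + (Y + (Y + 0ℚ))) < X + (Y + (Y + Y))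
13/12-gap X 0<X = subst₂ _<_ (sym (factor-l X)) (sym (factor-r X))
  (*-monoʳ-<-pos X {{positive 0<X}} (toWitness {a? = lhs <? rhs} tt))
  where
  open +-*-Solver
  lhs rhs : ℚ
  lhs = 13/12 * (1ℚ + (⅓ * ⅓ + (⅓ * ⅓ + 0ℚ)))
  rhs = 1ℚ + (⅓ * ⅓ + (⅓ * ⅓ + ⅓ * ⅓))
  factor-l : ∀ X → 13/12 * (X + (X * ⅓ * ⅓ + (X * ⅓ * ⅓ + 0ℚ))) ≡ X * lhs
  factor-l = solve 1 (λ x →
      con 13/12 :* (x :+ (x :* con ⅓ :* con ⅓ :+ (x :* con ⅓ :* con ⅓ :+ con 0ℚ)))
      := x :* (con 13/12 :* (con 1ℚ :+ (con ⅓ :* con ⅓ :+ (con ⅓ :* con ⅓ :+ con 0ℚ))))) refl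
  factor-r : ∀ X → X + (X * ⅓ * ⅓ + (X * ⅓ * ⅓ + X * ⅓ * ⅓)) ≡ X * rhs
  factor-r = solve 1 (λ x →
      x :+ (x :* con ⅓ :* con ⅓ :+ (x :* con ⅓ :* con ⅓ :+ x :* con ⅓ :* con ⅓))
      := x :* (con 1ℚ :+ (con ⅓ :* con ⅓ :+ (con ⅓ :* con ⅓ :+ con ⅓ :* con ⅓)))) refl

module _ {m : ℕ} (i j : Fin m) (j≡1+i : toℕ j ≡ suc (toℕ i)) (k : Fin 5) where

  private
    X Y : ℚ
    X = inv3^ (toℕ i)
    Y = cycle-weight j

  𝒫-walk : Walk (i , k) (j , next (next (cross k)))
  𝒫-walk = crossE i j j≡1+i k ∷ arc² j (cross k)

  cycles-≢ : ∀ {a b} → (i , a) ≢ (j , b)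
  cycles-≢ eq = ℕ.1+n≢n (sym (trans (cong level eq) j≡1+i))

  𝒫-walk-isPath : IsPath 𝒫-walk
  𝒫-walk-isPath = (cycles-≢ ∷ cycles-≢ ∷ cycles-≢ ∷ [])
                ∷ (rotate-≢ j (# 0) ∷ rotate-≢ j (# 1) ∷ [])
                ∷ (rotate-≢ j (# 0) ∷ [])
                ∷ [] ∷ []

  detour-≥ : ∀ {w v} (e : Edge (i , k) w) (q : Walk w v) →
             level w ℕ.≤ toℕ i → level v ≡ toℕ j →
             X + (Y + (Y + Y)) ≤ weight (e ∷ q)
  detour-≥ e q w≤i v≡j = ≤-trans (≤-reflexive (+-comm X (Y + (Y + Y))))
    (+-mono-≤ (≤-trans (≤-reflexive three-arcs) (weightE-≥-source e))
              (weight-≥-cut (toℕ i) q w≤i (ℕ.≤-reflexive (sym (trans v≡j j≡1+i)))))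
    where
    three-arcs : Y + (Y + Y) ≡ inv3^ (suc (toℕ i))
    three-arcs = trans (inv3^-triple (toℕ j)) (cong inv3^ j≡1+i)

  𝒫-walk-or-≥ : ∀ {v} (q : Walk (i , k) v) → v ≡ (j , next (next (cross k))) →
                q ≋ 𝒫-walk ⊎ X + (Y + (Y + Y)) ≤ weight q
  𝒫-walk-or-≥ [ _ ] v≡ = ⊥-elim (cycles-≢ v≡)
  𝒫-walk-or-≥ (crossE _ j′ j′≡1+i _ ∷ q) v≡
    with toℕ-injective (trans j′≡1+i (sym j≡1+i))
  ... | refl = map (∷-≋ refl) (+-monoʳ-≤ X) (arc²-or-≥3 j q v≡)
  𝒫-walk-or-≥ (e@(cyc _ _) ∷ q) v≡ = inj₂ (detour-≥ e q ℕ.≤-refl (cong level v≡))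
  𝒫-walk-or-≥ (e@(cycᵒ _ _) ∷ q) v≡ = inj₂ (detour-≥ e q ℕ.≤-refl (cong level v≡))
  𝒫-walk-or-≥ (e@(crossEᵒ _ _ i≡1+i₀ _) ∷ q) v≡ =
    inj₂ (detour-≥ e q (ℕ.≤-trans (ℕ.n≤1+n _) (ℕ.≤-reflexive (sym i≡1+i₀)))
                       (cong level v≡))

  𝒫-walk-shortest : (q : Walk (i , k) (j , next (next (cross k)))) → weight 𝒫-walk ≤ weight q
  𝒫-walk-shortest q with 𝒫-walk-or-≥ q refl
  ... | inj₁ q≋𝒫 = ≤-reflexive (sym (_≋_.same-weight q≋𝒫))
  ... | inj₂ heavy =
    ≤-trans (+-monoʳ-≤ X (+-monoʳ-≤ Y (+-monoʳ-≤ Y (inv3^-nonNeg (suc (toℕ j)))))) heavy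

  𝒫-walk-approxSP : IsApproxSP 13/12 𝒫-walk
  𝒫-walk-approxSP = 𝒫-walk-isPath , λ q _ →
    ≤-trans (𝒫-walk-shortest q) (p≤r*p (toWitness {a? = 1ℚ ≤? 13/12} tt) (weight-nonNeg q))

  approxSP-vertices : (q : Walk (i , k) (j , next (next (cross k)))) → IsApproxSP 13/12 q →
                      vertices q ≡ 𝒫-path i j k
  approxSP-vertices q (_ , q≤) with 𝒫-walk-or-≥ q refl
  ... | inj₁ q≋𝒫 = _≋_.same-vertices q≋𝒫
  ... | inj₂ heavy =
    ⊥-elim (<-irrefl refl (<-≤-trans gap (≤-trans heavy (q≤ 𝒫-walk 𝒫-walk-isPath))))
    where
    gap : 13/12 * weight 𝒫-walk < X + (Y + (Y + Y))
    gap = subst (λ Y → 13/12 * (X + (Y + (Y + 0ℚ))) < X + (Y + (Y + Y)))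
                (cong (inv3^ ∘ suc) (sym j≡1+i)) (13/12-gap X (inv3^-positive (toℕ i)))

lemma3p3 : (n : ℕ) → 5 ∣ n →
    (i j : Fin (n / 5)) → toℕ j ≡ suc (toℕ i) → (k : Fin 5) →
    (Σ (Walk (i , k) (j , next (next (cross k)))) λ p → IsApproxSP (+ 13 /ℚ 12) p × vertices p ≡ 𝒫-path i j k)
    × ((q : Walk (i , k) (j , next (next (cross k)))) → IsApproxSP (+ 13 /ℚ 12) q → vertices q ≡ 𝒫-path i j k)
lemma3p3 n _ i j j≡1+i k =
  (𝒫-walk i j j≡1+i k , 𝒫-walk-approxSP i j j≡1+i k , refl) , approxSP-vertices i j j≡1+i k
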